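{- If the triple $(a,b,c)$ of positive integers is good, then $\gcd(b,c)\in\{1,2\}$. Furthermore, if $\gcd(b,c)=2$, then $a$ is even.
   Context: For positive integers $a,b,c$ with $n=a+b+c$, the permutation of the triple $(a,b,c)$ is the permutation of $[n]$ with $p_i=n+1-i$ for $1\le i\le a$, $p_i=a+b+1-i$ for $a+1\le i\le a+b$, and $p_i=n+b+1-i$ for $a+b+1\le i\le n$ (one-line notation $n\cdots(n-a+1)\ b\cdots1\ (b+c)\cdots(b+1)$). The triple is good if this permutation, as a bijection $i\mapsto p_i$ of $[n]$, is a single $n$-cycle. -}

module Defs where

open import Data.Nat using (ℕ; zero; suc; _+_; _∸_; _≤_; _≤ᵇ_)
open import Data.Bool using (if_then_else_)
open import Data.Product using (∃; _×_)
open import Function using (_∘_)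
open import Relation.Binary.PropositionalEquality using (_≡_)

iter : (ℕ → ℕ) → ℕ → ℕ → ℕ
iter f zero    x = x
iter f (suc k) x = f (iter f k x)

-- The permutation of the triple (a,b,c), as a map on ℕ whose values on
-- [n] = {1,…,n} (n = a+b+c) are the paper's p_i.
tripPerm : ℕ → ℕ → ℕ → ℕ → ℕ
tripPerm a b c i =
  if i ≤ᵇ a then (a + b + c + 1) ∸ i
  else if i ≤ᵇ a + b then (a + b + 1) ∸ i
  else (a + b + c + b + 1) ∸ i

-- A bijection p of [n] is a single n-cycle iff it has exactly one orbit on [n]:
-- every element of [n] is reached from every other by iterating p.
IsSingleCycle : ℕ → (ℕ → ℕ) → Set
IsSingleCycle n p =
  ∀ i j → 1 ≤ i → i ≤ n → 1 ≤ j → j ≤ n → ∃ λ k → iter p k i ≡ j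

Good : ℕ → ℕ → ℕ → Set
Good a b c = IsSingleCycle (a + b + c) (tripPerm a b c)

-- Write n = a+b+c and p = tripPerm a b c. On each of its three blocks p is a
-- reflection x ↦ s ∸ x, and the three centres s are n+1, n+1-c and n+1+b. So if
-- d divides both b and c, then modulo d the map p acts on all of [n] as the single
-- reflection x ↦ (n+1) - x. A reflection is an involution, hence every iterate of
-- p starting from i is congruent to i or to (n+1) - i modulo d. When p is a single
-- n-cycle the orbit of 1 is all of [n], so each j ∈ [n] is ≡ 1 or ≡ n modulo d.
-- Applying this to j = 2 and j = 3 (n ≥ 3) gives d ∣ 2; for d = 2 the case 2 ≡ 1
-- is impossible, so 2 ≡ n (mod 2), and n = a+b+c with b, c even gives a even.
module Submission where

open import Defs
open import Data.Nat using (ℕ; _≤_)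
open import Data.Nat.GCD using (gcd)
open import Data.Nat.Divisibility using (_∣_)
open import Data.Sum using (_⊎_)
open import Data.Product using (_×_)
open import Relation.Binary.PropositionalEquality using (_≡_)

open import Data.Nat using (zero; suc; _+_; _∸_; _≤ᵇ_; _<_; s≤s; z≤n)
open import Data.Nat.Properties
  using (≤ᵇ-reflects-≤; ≰⇒>; ≤-trans; ≤-reflexive; +-comm; +-monoˡ-≤; +-mono-≤;
         m≤m+n; m≤n+m; m<n⇒0<n∸m; m≤n+o⇒m∸n≤o; <⇒≤; module ≤-Reasoning)
open import Data.Nat.Divisibility using (∣⇒≤; 0∣⇒≡0; ∣-trans; 1∣_; _∣0)
open import Data.Nat.GCD using (gcd[m,n]∣m; gcd[m,n]∣n)
import Data.Nat.Tactic.RingSolver as ℕ-Solver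
open import Data.Integer using (ℤ; +_; -_) renaming (_+_ to _+ℤ_; _-_ to _-ℤ_)
open import Data.Integer.Properties using (m-n≡m⊖n; ⊖-≥)
import Data.Integer.Divisibility.Signed as ℤ∣
import Data.Integer.Tactic.RingSolver as ℤ-Solver
open import Data.Product using (_,_; proj₁; proj₂; ∃)
open import Data.Sum using (inj₁; inj₂)
open import Data.Bool using (true; false)
open import Relation.Nullary.Reflects using (ofʸ; ofⁿ)
open import Relation.Binary.PropositionalEquality using (refl; sym; trans; cong; subst)

-- Congruence of integers modulo a natural number d: d divides the difference.
-- (A record, so that x and y stay inferable from the type.)
infix 4 _≡_mod_
record _≡_mod_ (x y : ℤ) (d : ℕ) : Set where
  constructor congruent
  field divides : (+ d) ℤ∣.∣ (x -ℤ y)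
open _≡_mod_ using (divides)

module _ {d : ℕ} where

  mod-via : ∀ {x y e} → x -ℤ y ≡ e → (+ d) ℤ∣.∣ e → x ≡ y mod d
  mod-via x-y≡e d∣e = congruent (subst ((+ d) ℤ∣.∣_) (sym x-y≡e) d∣e)

  mod-reflexive : ∀ {x y} → x ≡ y → x ≡ y mod d
  mod-reflexive {x} refl = mod-via (identity x) (ℤ∣.∣ᵤ⇒∣ (d ∣0))
    where
    identity : ∀ x → x -ℤ x ≡ + 0
    identity = ℤ-Solver.solve-∀

  mod-sym : ∀ {x y} → x ≡ y mod d → y ≡ x mod d
  mod-sym {x} {y} x≡y = mod-via (identity x y) (ℤ∣.∣m⇒∣-m (divides x≡y))
    where
    identity : ∀ x y → y -ℤ x ≡ - (x -ℤ y)
    identity = ℤ-Solver.solve-∀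

  mod-trans : ∀ {x y z} → x ≡ y mod d → y ≡ z mod d → x ≡ z mod d
  mod-trans {x} {y} {z} x≡y y≡z = mod-via (identity x y z) (ℤ∣.∣m∣n⇒∣m+n (divides x≡y) (divides y≡z))
    where
    identity : ∀ x y z → x -ℤ z ≡ (x -ℤ y) +ℤ (y -ℤ z)
    identity = ℤ-Solver.solve-∀

  mod-congˡ : ∀ {x y} z → x ≡ y mod d → x -ℤ z ≡ y -ℤ z mod d
  mod-congˡ {x} {y} z x≡y = mod-via (identity x y z) (divides x≡y)
    where
    identity : ∀ x y z → (x -ℤ z) -ℤ (y -ℤ z) ≡ x -ℤ y
    identity = ℤ-Solver.solve-∀

  mod-congʳ : ∀ m {x y} → x ≡ y mod d → m -ℤ x ≡ m -ℤ y mod d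
  mod-congʳ m {x} {y} x≡y = mod-via (identity m x y) (divides (mod-sym x≡y))
    where
    identity : ∀ m x y → (m -ℤ x) -ℤ (m -ℤ y) ≡ y -ℤ x
    identity = ℤ-Solver.solve-∀

InRange : ℕ → ℕ → Set
InRange n x = 1 ≤ x × x ≤ n

record ReflectsMod (d : ℕ) (m : ℤ) (n : ℕ) (p : ℕ → ℕ) : Set where
  field
    into    : ∀ {x} → InRange n x → InRange n (p x)
    reflect : ∀ {x} → InRange n x → + p x ≡ m -ℤ + x mod d

OrbitResidue : ℕ → ℤ → ℕ → ℕ → Set
OrbitResidue d m i x = + x ≡ + i mod d ⊎ + x ≡ m -ℤ + i mod d

module _ {d n : ℕ} {m : ℤ} {p : ℕ → ℕ} (R : ReflectsMod d m n p) where
  open ReflectsMod R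

  -- Iterates of p stay in [n] and alternate between the residues of i and m - i,
  -- because the reflection x ↦ m - x is an involution.
  orbit-residue : ∀ {i} → InRange n i → ∀ k →
    InRange n (iter p k i) × OrbitResidue d m i (iter p k i)
  orbit-residue {i} i∈[n] zero = i∈[n] , inj₁ (mod-reflexive refl)
  orbit-residue {i} i∈[n] (suc k) with orbit-residue i∈[n] k
  ... | x∈[n] , residue = into x∈[n] , next residue
    where
    x : ℕ
    x = iter p k i
    next : OrbitResidue d m i x → OrbitResidue d m i (p x)
    next (inj₁ x≡i)   = inj₂ (mod-trans (reflect x∈[n]) (mod-congʳ m x≡i))
    next (inj₂ x≡m-i) = inj₁ (mod-trans (reflect x∈[n])
                         (mod-trans (mod-congʳ m x≡m-i) (mod-reflexive (involution m (+ i)))))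
      where
      involution : ∀ m i → m -ℤ (m -ℤ i) ≡ i
      involution = ℤ-Solver.solve-∀

  cycle-residue : IsSingleCycle n p → ∀ {j} → InRange n j → OrbitResidue d m 1 j
  cycle-residue cycle {j} (1≤j , j≤n) =
    subst (OrbitResidue d m 1) (proj₂ 1↝j) (proj₂ (orbit-residue 1∈[n] (proj₁ 1↝j)))
    where
    1∈[n] : InRange n 1
    1∈[n] = s≤s z≤n , ≤-trans 1≤j j≤n
    1↝j : ∃ λ k → iter p k 1 ≡ j
    1↝j = cycle 1 j (proj₁ 1∈[n]) (proj₂ 1∈[n]) 1≤j j≤n

-- The three centres of the reflections making up tripPerm a b c: n+1 on the first
-- block, a+b+1 = (n+1) - c on the second and n+b+1 = (n+1) + b on the third.
data Centre (a b c : ℕ) : ℕ → Set where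
  whole  : Centre a b c (a + b + c + 1)
  middle : Centre a b c (a + b + 1)
  last   : Centre a b c (a + b + c + b + 1)

centre-mod : ∀ {a b c d s} → d ∣ b → d ∣ c → Centre a b c s →
  + s ≡ + (a + b + c + 1) mod d
centre-mod _ _ whole = mod-reflexive refl
centre-mod {a} {b} {c} _ d∣c middle =
  mod-via (identity (+ a) (+ b) (+ c)) (ℤ∣.∣m⇒∣-m (ℤ∣.∣ᵤ⇒∣ d∣c))
  where
  identity : ∀ a b c → (a +ℤ b +ℤ + 1) -ℤ (a +ℤ b +ℤ c +ℤ + 1) ≡ - c
  identity = ℤ-Solver.solve-∀
centre-mod {a} {b} {c} d∣b _ last =
  mod-via (identity (+ a) (+ b) (+ c)) (ℤ∣.∣ᵤ⇒∣ d∣b)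
  where
  identity : ∀ a b c → (a +ℤ b +ℤ c +ℤ b +ℤ + 1) -ℤ (a +ℤ b +ℤ c +ℤ + 1) ≡ b
  identity = ℤ-Solver.solve-∀

-- y is the image of x under the reflection x ↦ s ∸ x about one of the centres s,
-- where x < s ≤ x + n guarantees that s ∸ x lies in [n] again.
record ReflectionAt (a b c x y : ℕ) : Set where
  field
    centre   : ℕ
    kind     : Centre a b c centre
    acts     : y ≡ centre ∸ x
    x<centre : x < centre
    centre≤  : centre ≤ x + (a + b + c)

-- Strict bound from a weak one, with the successor written as m + 1 as in tripPerm.
≤⇒<+1 : ∀ {x m} → x ≤ m → x < m + 1
≤⇒<+1 {x} {m} x≤m = ≤-trans (s≤s x≤m) (≤-reflexive (+-comm 1 m))

tripPerm-reflection : ∀ a b c {x} → InRange (a + b + c) x →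
  ReflectionAt a b c x (tripPerm a b c x)
tripPerm-reflection a b c {x} (1≤x , x≤n)
  with x ≤ᵇ a | ≤ᵇ-reflects-≤ x a
... | true | ofʸ _ = record
  { centre = n + 1 ; kind = whole ; acts = refl ; x<centre = ≤⇒<+1 x≤n
  ; centre≤ = ≤-trans (≤-reflexive (+-comm n 1)) (+-monoˡ-≤ n 1≤x) }
  where
  n : ℕ
  n = a + b + c
... | false | ofⁿ x≰a with x ≤ᵇ a + b | ≤ᵇ-reflects-≤ x (a + b)
...   | true | ofʸ x≤a+b = record
  { centre = a + b + 1 ; kind = middle ; acts = refl ; x<centre = ≤⇒<+1 x≤a+b
  ; centre≤ = begin
      a + b + 1   ≡⟨ identity a b ⟩
      suc a + b   ≤⟨ +-mono-≤ (≰⇒> x≰a) (≤-trans (m≤n+m b a) (m≤m+n (a + b) c)) ⟩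
      x + n       ∎ }
  where
  open ≤-Reasoning
  n : ℕ
  n = a + b + c
  identity : ∀ a b → a + b + 1 ≡ suc a + b
  identity = ℕ-Solver.solve-∀
...   | false | ofⁿ x≰a+b = record
  { centre = n + b + 1 ; kind = last ; acts = refl
  ; x<centre = ≤⇒<+1 (≤-trans x≤n (m≤m+n n b))
  ; centre≤ = begin
      n + b + 1       ≡⟨ identity n b ⟩
      suc b + n       ≤⟨ +-monoˡ-≤ n (s≤s (m≤n+m b a)) ⟩
      suc (a + b) + n ≤⟨ +-monoˡ-≤ n (≰⇒> x≰a+b) ⟩
      x + n           ∎ }
  where
  open ≤-Reasoning
  n : ℕ
  n = a + b + c
  identity : ∀ n b → n + b + 1 ≡ suc b + n
  identity = ℕ-Solver.solve-∀

tripPerm-reflects : ∀ {a b c d} → d ∣ b → d ∣ c →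
  ReflectsMod d (+ (a + b + c + 1)) (a + b + c) (tripPerm a b c)
tripPerm-reflects {a} {b} {c} {d} d∣b d∣c = record { into = into ; reflect = reflect }
  where
  into : ∀ {x} → InRange (a + b + c) x → InRange (a + b + c) (tripPerm a b c x)
  into {x} x∈[n] = subst (InRange (a + b + c)) (sym acts)
    (m<n⇒0<n∸m x<centre , m≤n+o⇒m∸n≤o centre x centre≤)
    where open ReflectionAt (tripPerm-reflection a b c x∈[n])
  reflect : ∀ {x} → InRange (a + b + c) x → + tripPerm a b c x ≡ + (a + b + c + 1) -ℤ + x mod d
  reflect {x} x∈[n] = mod-trans (mod-reflexive value) (mod-congˡ (+ x) (centre-mod d∣b d∣c kind))
    where
    open ReflectionAt (tripPerm-reflection a b c x∈[n])
    value : + tripPerm a b c x ≡ + centre -ℤ + x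
    value = trans (cong +_ acts) (sym (trans (m-n≡m⊖n centre x) (⊖-≥ (<⇒≤ x<centre))))

-- If both 2 and 3 are ≡ 1 or ≡ m - 1 modulo d, then d ∣ 2: either one of them is
-- ≡ 1 (so d ∣ 1 or d ∣ 2), or both are ≡ m - 1 and hence 3 ≡ 2.
two-and-three : ∀ {d m} → OrbitResidue d m 1 2 → OrbitResidue d m 1 3 → d ∣ 2
two-and-three (inj₁ 2≡1) _                = ∣-trans (ℤ∣.∣⇒∣ᵤ (divides 2≡1)) (1∣ 2)
two-and-three (inj₂ _)     (inj₁ 3≡1)     = ℤ∣.∣⇒∣ᵤ (divides 3≡1)
two-and-three (inj₂ 2≡m-1) (inj₂ 3≡m-1)   =
  ∣-trans (ℤ∣.∣⇒∣ᵤ (divides (mod-trans 3≡m-1 (mod-sym 2≡m-1)))) (1∣ 2)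

divisor-of-two : ∀ {d} → d ∣ 2 → d ≡ 1 ⊎ d ≡ 2
divisor-of-two {zero} 0∣2 with 0∣⇒≡0 0∣2
... | ()
divisor-of-two {suc zero} _ = inj₁ refl
divisor-of-two {suc (suc zero)} _ = inj₂ refl
divisor-of-two {suc (suc (suc _))} d∣2 with ∣⇒≤ d∣2
... | s≤s (s≤s ())

-- For d = 2 the residue 1 is impossible for j = 2, so 2 ≡ n (mod 2); as b and c
-- are even, so is a = n - b - c.
first-length-even : ∀ {a b c} → 2 ∣ b → 2 ∣ c → OrbitResidue 2 (+ (a + b + c + 1)) 1 2 → 2 ∣ a
first-length-even _ _ (inj₁ 2≡1) with ∣⇒≤ (ℤ∣.∣⇒∣ᵤ (divides 2≡1))
... | s≤s ()
first-length-even {a} {b} {c} 2∣b 2∣c (inj₂ 2≡n) =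
  ℤ∣.∣⇒∣ᵤ (subst ((+ 2) ℤ∣.∣_) (identity (+ a) (+ b) (+ c))
    (ℤ∣.∣m∣n⇒∣m-n (ℤ∣.∣m∣n⇒∣m-n (ℤ∣.∣m∣n⇒∣m-n ℤ∣.∣-refl (divides 2≡n)) (ℤ∣.∣ᵤ⇒∣ 2∣b)) (ℤ∣.∣ᵤ⇒∣ 2∣c)))
  where
  identity : ∀ a b c → + 2 -ℤ (+ 2 -ℤ ((a +ℤ b +ℤ c +ℤ + 1) -ℤ + 1)) -ℤ b -ℤ c ≡ a
  identity = ℤ-Solver.solve-∀

lemma6 : (a b c : ℕ) → 1 ≤ a → 1 ≤ b → 1 ≤ c → Good a b c →
    (gcd b c ≡ 1 ⊎ gcd b c ≡ 2) × (gcd b c ≡ 2 → 2 ∣ a)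
lemma6 a b c 1≤a 1≤b 1≤c good = divisor-of-two gcd∣2 , gcd≡2⇒a-even
  where
  n = a + b + c
  3≤n : 3 ≤ n
  3≤n = +-mono-≤ (+-mono-≤ 1≤a 1≤b) 1≤c
  2∈[n] : InRange n 2
  2∈[n] = s≤s z≤n , ≤-trans (s≤s (s≤s z≤n)) 3≤n
  3∈[n] : InRange n 3
  3∈[n] = s≤s z≤n , 3≤n
  residue : ∀ {d} → d ∣ b → d ∣ c → ∀ {j} → InRange n j → OrbitResidue d (+ (n + 1)) 1 j
  residue d∣b d∣c = cycle-residue (tripPerm-reflects d∣b d∣c) good
  gcd∣2 : gcd b c ∣ 2
  gcd∣2 = two-and-three {m = + (n + 1)} (residue (gcd[m,n]∣m b c) (gcd[m,n]∣n b c) 2∈[n])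
                                         (residue (gcd[m,n]∣m b c) (gcd[m,n]∣n b c) 3∈[n])
  gcd≡2⇒a-even : gcd b c ≡ 2 → 2 ∣ a
  gcd≡2⇒a-even gcd≡2 = first-length-even 2∣b 2∣c (residue 2∣b 2∣c 2∈[n])
    where
    2∣b : 2 ∣ b
    2∣b = subst (_∣ b) gcd≡2 (gcd[m,n]∣m b c)
    2∣c : 2 ∣ c
    2∣c = subst (_∣ c) gcd≡2 (gcd[m,n]∣n b c)
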